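{- Let $y$ be a string whose last character is a unique symbol $\$$ not occurring elsewhere in $y$. Let $\mathcal{L}=\{\overrightarrow{x} : x\in\mathrm{Substr}(y)\}$ and $\mathcal{R}=\{\overleftarrow{x}^{\,\mathrm{R}} : x\in\mathrm{Substr}(y)\}$, and let $\mathsf{BT}(y)$ be the trie whose nodes are the strings in $\mathcal{R}$ (a string $u\in\mathcal{R}$ is a descendant of $v\in\mathcal{R}$ iff $v$ is a prefix of $u$). Then every leaf of $\mathsf{BT}(y)$, i.e. every $\ell\in\mathcal{R}$ such that no element of $\mathcal{R}$ has $\ell$ as a proper prefix, belongs to $\mathcal{L}$, i.e. is a node of the suffix tree $\mathsf{ST}(y)$.
   Context: $\mathrm{Substr}(y)$ is the set of substrings of $y$. For $x\in\Sigma^*$, $\mathrm{BegPos}(x)=\{i : y[i..i+|x|-1]=x\}$ and $\mathrm{EndPos}(x)=\{i : y[i-|x|+1..i]=x\}$; $\overrightarrow{x}$ (resp. $\overleftarrow{x}^{\,\mathrm{R}}$) is the longest string with the same BegPos (resp. EndPos) as $x$. The nodes of the suffix tree $\mathsf{ST}(y)$ are exactly the strings in $\mathcal{L}$. The set $\mathcal{R}$ is prefix-closed, so $\mathsf{BT}(y)$ is a trie. -}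

module Defs where

open import Data.Nat using (ℕ; _≤_)
open import Data.List using (List; []; _∷_; _++_; length)
open import Data.Product using (Σ; ∃; _×_; _,_)
open import Relation.Binary.PropositionalEquality using (_≡_)
open import Relation.Nullary using (¬_)

-- Strings over an alphabet A are lists; positions are 0-indexed.

module _ {A : Set} (y : List A) where

  Substr : List A → Set
  Substr x = ∃ λ u → ∃ λ v → y ≡ u ++ x ++ v

  BegPos : List A → ℕ → Set
  BegPos x i = ∃ λ u → ∃ λ v → (y ≡ u ++ x ++ v) × (length u ≡ i)

  -- j ∈ EndPos(x): an occurrence of x in y ends at position j
  -- (j = number of characters up to and including the last one of x;
  --  this is the paper's EndPos shifted by a constant 1)
  EndPos : List A → ℕ → Set
  EndPos x j = ∃ λ u → ∃ λ v → (y ≡ u ++ x ++ v) × (length (u ++ x) ≡ j)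

  SameBegPos : List A → List A → Set
  SameBegPos x z = ∀ i → (BegPos x i → BegPos z i) × (BegPos z i → BegPos x i)

  SameEndPos : List A → List A → Set
  SameEndPos x z = ∀ j → (EndPos x j → EndPos z j) × (EndPos z j → EndPos x j)

  IsRightExt : List A → List A → Set
  IsRightExt x z = SameBegPos x z × (∀ w → SameBegPos x w → length w ≤ length z)

  IsLeftExt : List A → List A → Set
  IsLeftExt x z = SameEndPos x z × (∀ w → SameEndPos x w → length w ≤ length z)

  InL : List A → Set
  InL z = ∃ λ x → Substr x × IsRightExt x z

  InR : List A → Set
  InR z = ∃ λ x → Substr x × IsLeftExt x z

ProperPrefix : {A : Set} → List A → List A → Set
ProperPrefix p u = ∃ λ c → ∃ λ cs → u ≡ p ++ c ∷ cs

IsLeafBT : {A : Set} → List A → List A → Set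
IsLeafBT y ℓ = InR y ℓ × (∀ u → InR y u → ¬ ProperPrefix ℓ u)

-- Let ℓ = ←x be a leaf of BT(y).  If ℓ were not right-maximal, i.e. some
-- longer string had the same BegPos, every occurrence of ℓ would continue
-- with the same nonempty word s.  Then ℓs occurs, and it is left-maximal
-- because ℓ is: a word always preceding ℓs would always precede ℓ, giving a
-- longer string with the EndPos of ℓ.  So ℓs = ←(ℓs) lies in 𝓡 and has ℓ as a
-- proper prefix, contradicting leafhood.
module Submission where

open import Defs
open import Data.List using (List; []; _∷_; _++_; length)
open import Data.List.Membership.Propositional using (_∉_)
open import Data.List.Properties
  using (++-assoc; ∷-injective; ∷-injectiveʳ; ++-cancelˡ; ++-cancelʳ; length-++-≤ʳ)
open import Data.Nat using (_<_; s≤s)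
open import Data.Nat.Properties using (suc-injective; <-irrefl; <⇒≤; ≤⇒≯; ≮⇒≥)
open import Data.Product using (∃; ∃₂; _×_; _,_; proj₁; proj₂)
open import Data.Empty using (⊥-elim)
open import Function using (id)
open import Relation.Nullary using (¬_)
open import Relation.Binary.PropositionalEquality
  using (_≡_; refl; sym; trans; cong; module ≡-Reasoning)

module _ {A : Set} where

  ++-cancel-length : ∀ (u u' : List A) {v v'} →
                     length u ≡ length u' → u ++ v ≡ u' ++ v' → u ≡ u' × v ≡ v'
  ++-cancel-length []      []       _   eq = refl , eq
  ++-cancel-length (a ∷ u) (b ∷ u') len eq with refl , eq′ ← ∷-injective eq
    with refl , refl ← ++-cancel-length u u' (suc-injective len) eq′ = refl , refl

  ++-properPrefix : ∀ (u u' : List A) {v v'} →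
                    u ++ v ≡ u' ++ v' → length u < length u' → ∃₂ λ c t → u' ≡ u ++ c ∷ t
  ++-properPrefix []      (c ∷ t)  _  _        = c , t , refl
  ++-properPrefix (a ∷ u) (b ∷ u') eq (s≤s lt) with refl , eq′ ← ∷-injective eq
    with c , t , refl ← ++-properPrefix u u' eq′ lt = c , t , refl

  ++-properSuffix : ∀ (u u' : List A) {x z} →
                    u ++ x ≡ u' ++ z → length x < length z → ∃₂ λ d p → z ≡ d ∷ p ++ x
  ++-properSuffix []      []       refl lt = ⊥-elim (<-irrefl refl lt)
  ++-properSuffix (d ∷ p) []       refl _  = d , p , refl
  ++-properSuffix []      (b ∷ u') {z = z} refl lt =
    ⊥-elim (≤⇒≯ (length-++-≤ʳ z {u'}) (<⇒≤ lt))
  ++-properSuffix (a ∷ u) (b ∷ u') eq   lt = ++-properSuffix u u' (∷-injectiveʳ eq) lt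

  ++-reassoc : ∀ (u x u' z : List A) {v v'} →
               u ++ x ++ v ≡ u' ++ z ++ v' → (u ++ x) ++ v ≡ (u' ++ z) ++ v'
  ++-reassoc u x u' z {v} {v'} eq = trans (++-assoc u x v) (trans eq (sym (++-assoc u' z v')))

  ++-cancel-commonSuffix : ∀ (u x u' z v : List A) → u ++ x ++ v ≡ u' ++ z ++ v → u ++ x ≡ u' ++ z
  ++-cancel-commonSuffix u x u' z v eq = ++-cancelʳ v (u ++ x) (u' ++ z) (++-reassoc u x u' z eq)

module Occurrences {A : Set} (y : List A) where

  ExtendsRight : List A → List A → Set
  ExtendsRight x s = ∀ u v → y ≡ u ++ x ++ v → ∃ λ v' → y ≡ u ++ (x ++ s) ++ v'

  ExtendsLeft : List A → List A → Set
  ExtendsLeft x p = ∀ u v → y ≡ u ++ x ++ v → ∃ λ u' → y ≡ u' ++ (p ++ x) ++ v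

  RightMaximal : List A → Set
  RightMaximal x = ∀ c s → ¬ ExtendsRight x (c ∷ s)

  LeftMaximal : List A → Set
  LeftMaximal x = ∀ d p → ¬ ExtendsLeft x (d ∷ p)

  sameBegPos-align : ∀ {x w} → SameBegPos y x w →
                     ∀ u v → y ≡ u ++ x ++ v → ∃ λ v' → y ≡ u ++ w ++ v'
  sameBegPos-align same u v occ
    with u' , v' , occ' , len ← proj₁ (same (length u)) (u , v , occ , refl)
    with refl , _ ← ++-cancel-length u u' (sym len) (trans (sym occ) occ') = v' , occ'

  sameEndPos-align : ∀ {x z} → SameEndPos y x z →
                     ∀ u v → y ≡ u ++ x ++ v → ∃ λ u' → y ≡ u' ++ z ++ v
  sameEndPos-align {x} {z} same u v occ
    with u' , v' , occ' , len ← proj₁ (same (length (u ++ x))) (u , v , occ , refl)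
    with _ , refl ← ++-cancel-length (u ++ x) (u' ++ z) (sym len)
                      (++-reassoc u x u' z (trans (sym occ) occ')) = u' , occ'

  substr-sameEndPos : ∀ {x z} → Substr y x → SameEndPos y x z → Substr y z
  substr-sameEndPos (u , v , occ) same with u' , occ' ← sameEndPos-align same u v occ = u' , v , occ'

  substr-extendsRight : ∀ {x s} → Substr y x → ExtendsRight x s → Substr y (x ++ s)
  substr-extendsRight (u , v , occ) ext with v' , occ' ← ext u v occ = u , v' , occ'

  sameEndPos-trans : ∀ {x z w} → SameEndPos y x z → SameEndPos y z w → SameEndPos y x w
  sameEndPos-trans xz zw j = (λ e → proj₁ (zw j) (proj₁ (xz j) e)) ,
                             (λ e → proj₂ (xz j) (proj₂ (zw j) e))

  sameBegPos-longer⇒extendsRight : ∀ {x w} → Substr y x → SameBegPos y x w →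
                                   length x < length w → ∃₂ λ c s → ExtendsRight x (c ∷ s)
  sameBegPos-longer⇒extendsRight {x} {w} (u , v , occ) same lt
    with v' , occ' ← sameBegPos-align same u v occ
    with c , s , refl ← ++-properPrefix x w (++-cancelˡ u _ _ (trans (sym occ) occ')) lt =
      c , s , sameBegPos-align same

  sameEndPos-longer⇒extendsLeft : ∀ {x z} → Substr y x → SameEndPos y x z →
                                  length x < length z → ∃₂ λ d p → ExtendsLeft x (d ∷ p)
  sameEndPos-longer⇒extendsLeft {x} {z} (u , v , occ) same lt
    with u' , occ' ← sameEndPos-align same u v occ
    with d , p , refl ←
           ++-properSuffix u u' (++-cancel-commonSuffix u x u' z v (trans (sym occ) occ')) lt =
      d , p , sameEndPos-align same

  extendsLeft⇒sameEndPos : ∀ {x p} → ExtendsLeft x p → SameEndPos y x (p ++ x)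
  extendsLeft⇒sameEndPos {x} {p} ext j = extend , shrink
    where
    extend : EndPos y x j → EndPos y (p ++ x) j
    extend (u , v , occ , len) with u' , occ' ← ext u v occ =
      u' , v , occ' ,
      trans (cong length (sym (++-cancel-commonSuffix u x u' (p ++ x) v (trans (sym occ) occ')))) len

    shrink : EndPos y (p ++ x) j → EndPos y x j
    shrink (u , v , occ , len) =
      u ++ p , v , trans occ (trans (cong (u ++_) (++-assoc p x v)) (sym (++-assoc u p (x ++ v)))) ,
      trans (cong length (++-assoc u p x)) len

  extendsLeft-++ : ∀ {x s p} → ExtendsRight x s → ExtendsLeft (x ++ s) p → ExtendsLeft x p
  extendsLeft-++ {x} {s} {p} right left u v occ
    with v' , occ₁ ← right u v occ
    with u' , occ₂ ← left u v' occ₁ = u' , (begin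
      y                      ≡⟨ occ ⟩
      u ++ x ++ v            ≡⟨ cong (_++ x ++ v) u≡u'p ⟩
      (u' ++ p) ++ x ++ v    ≡⟨ ++-assoc u' p (x ++ v) ⟩
      u' ++ p ++ x ++ v      ≡⟨ cong (u' ++_) (sym (++-assoc p x v)) ⟩
      u' ++ (p ++ x) ++ v    ∎)
    where
    open ≡-Reasoning
    u≡u'p : u ≡ u' ++ p
    u≡u'p = ++-cancelʳ ((x ++ s) ++ v') u (u' ++ p) (begin
      u ++ (x ++ s) ++ v'            ≡⟨ sym occ₁ ⟩
      y                              ≡⟨ occ₂ ⟩
      u' ++ (p ++ x ++ s) ++ v'      ≡⟨ cong (u' ++_) (++-assoc p (x ++ s) v') ⟩
      u' ++ p ++ (x ++ s) ++ v'      ≡⟨ sym (++-assoc u' p ((x ++ s) ++ v')) ⟩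
      (u' ++ p) ++ (x ++ s) ++ v'    ∎)

  leftMaximal-++ : ∀ {x s} → ExtendsRight x s → LeftMaximal x → LeftMaximal (x ++ s)
  leftMaximal-++ right maximal d p left = maximal d p (extendsLeft-++ right left)

  isLeftExt⇒leftMaximal : ∀ {x ℓ} → IsLeftExt y x ℓ → LeftMaximal ℓ
  isLeftExt⇒leftMaximal {ℓ = ℓ} (same , longest) d p ext =
    ≤⇒≯ (longest (d ∷ p ++ ℓ) (sameEndPos-trans same (extendsLeft⇒sameEndPos ext)))
        (s≤s (length-++-≤ʳ ℓ {p}))

  leftMaximal⇒isLeftExt : ∀ {x} → Substr y x → LeftMaximal x → IsLeftExt y x x
  leftMaximal⇒isLeftExt sub maximal = (λ _ → id , id) , λ z same → ≮⇒≥ λ lt →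
    let d , p , ext = sameEndPos-longer⇒extendsLeft sub same lt in maximal d p ext

  rightMaximal⇒isRightExt : ∀ {x} → Substr y x → RightMaximal x → IsRightExt y x x
  rightMaximal⇒isRightExt sub maximal = (λ _ → id , id) , λ w same → ≮⇒≥ λ lt →
    let c , s , ext = sameBegPos-longer⇒extendsRight sub same lt in maximal c s ext

lemma5 : {A : Set} (y w : List A) (dollar : A) →
         y ≡ w ++ dollar ∷ [] → dollar ∉ w →
         (ℓ : List A) → IsLeafBT y ℓ → InL y ℓ
lemma5 y _ _ _ _ ℓ ((x , subX , leftExt) , leaf) =
  ℓ , subℓ , rightMaximal⇒isRightExt subℓ rightMaximal
  where
  open Occurrences y

  subℓ : Substr y ℓ
  subℓ = substr-sameEndPos subX (proj₁ leftExt)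

  rightMaximal : RightMaximal ℓ
  rightMaximal c s ext = leaf (ℓ ++ c ∷ s) ℓs∈𝓡 (c , s , refl)
    where
    subℓs : Substr y (ℓ ++ c ∷ s)
    subℓs = substr-extendsRight subℓ ext

    ℓs∈𝓡 : InR y (ℓ ++ c ∷ s)
    ℓs∈𝓡 = ℓ ++ c ∷ s , subℓs ,
           leftMaximal⇒isLeftExt subℓs (leftMaximal-++ ext (isLeftExt⇒leftMaximal leftExt))
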